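{- Let $K$ be a field of characteristic not $2$ and let $(a_0,b_0)\in S_K$. Then $(a_0,b_0)\in S_K^{\mathrm{adv}_2}$ if and only if $\left(\frac{a_0+b_0}{2}\right)^2a_0b_0$ is a fourth power in $K$. Moreover, in this case, if $-1$ is a square in $K$, then every child of $(a_0,b_0)$ lies in $S_K^{\mathrm{adv}_1}$.
   Context: $S_K=\{(\alpha,\beta)\in K^2:\alpha,\beta,\alpha+\beta,\alpha-\beta\neq 0\}$. For $(\alpha,\beta),(\gamma,\delta)\in S_K$ write $(\alpha,\beta)\mapsto(\gamma,\delta)$, and call $(\gamma,\delta)$ a child of $(\alpha,\beta)$, if $2\gamma=\alpha+\beta$ and $\delta^2=\alpha\beta$. For $n\ge0$, $S_K^{\mathrm{adv}_n}$ is the set of $x_0\in S_K$ admitting $x_1,\dots,x_n\in S_K$ with $x_0\mapsto x_1\mapsto\cdots\mapsto x_n$. -}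

module Defs where

open import Level using (_⊔_; suc)
open import Algebra.Bundles using (CommutativeRing)
open import Data.Nat using (ℕ; zero) renaming (suc to 1+)
open import Data.Product using (_×_; _,_; Σ; ∃)
open import Relation.Nullary using (¬_)

-- The inverse operation
-- is total; its value at 0 is irrelevant (only the law for x ≉ 0 is imposed).
record Field (c ℓ : Level.Level) : Set (suc (c ⊔ ℓ)) where
  field
    commutativeRing : CommutativeRing c ℓ
  open CommutativeRing commutativeRing public
  field
    _⁻¹       : Carrier → Carrier
    0≉1       : ¬ (0# ≈ 1#)
    ⁻¹-inverse : ∀ x → ¬ (x ≈ 0#) → x * (x ⁻¹) ≈ 1#
  infix 8 _⁻¹

module FieldNotions {c ℓ} (F : Field c ℓ) where
  open Field F

  2# : Carrier
  2# = 1# + 1#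

  CharNot2 : Set ℓ
  CharNot2 = ¬ (2# ≈ 0#)

  IsSquare : Carrier → Set (c ⊔ ℓ)
  IsSquare x = ∃ λ t → x ≈ t * t

  IsFourthPower : Carrier → Set (c ⊔ ℓ)
  IsFourthPower x = ∃ λ t → x ≈ t * t * t * t

  K² : Set c
  K² = Carrier × Carrier

  InS : K² → Set ℓ
  InS (α , β) = ¬ (α ≈ 0#) × ¬ (β ≈ 0#) × ¬ (α + β ≈ 0#) × ¬ (α - β ≈ 0#)

  _↦_ : K² → K² → Set ℓ
  (α , β) ↦ (γ , δ) =
    InS (α , β) × InS (γ , δ) × (2# * γ ≈ α + β) × (δ * δ ≈ α * β)

  Adv : ℕ → K² → Set (c ⊔ ℓ)
  Adv zero   x = Level.Lift c (InS x)
  Adv (1+ n) x = InS x × ∃ λ y → x ↦ y × Adv n y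

{-# OPTIONS --safe #-}
module Submission where

-- A pair (α , β) ∈ S_K has a child exactly when αβ is a square: for s² = αβ the pair
-- ((α + β)/2 , s) lies in S_K because ((α + β)/2 + s)((α + β)/2 − s) = ((α − β)/2)² ≠ 0.
-- Hence (a , b) ∈ S_K^adv₂ iff γd is a square for γ = (a + b)/2 and some d with d² = ab.
-- If γd = u², then γ²ab = u⁴; conversely, if γ²ab = t⁴, then d = t²/γ works.
-- Any other child of (a , b) is (γ , εd) with ε² = 1. If −1 is a square, so is ε, and
-- so γεd is again a square.

open import Defs
open import Algebra.Bundles using (CommutativeRing)
open import Algebra.Solver.Ring.AlmostCommutativeRing
  using (fromCommutativeRing; _-Raw-AlmostCommutative⟶_)
import Algebra.Solver.Ring
import Algebra.Properties.AbelianGroup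
import Algebra.Properties.CommutativeSemigroup
import Algebra.Properties.Ring
import Algebra.Properties.Semiring.Mult
open import Data.Integer.Base as ℤ using (ℤ; +_; -[1+_]; _⊖_)
import Data.Integer.Properties as ℤ
open import Data.Maybe.Base using (Maybe; just; nothing)
open import Data.Nat.Base as ℕ using (ℕ; zero; suc)
import Data.Nat.Properties as ℕ
open import Data.Product using (_×_; _,_; proj₁; proj₂)
open import Function.Bundles using (_⇔_; mk⇔)
open import Level using (lift)
import Relation.Binary.PropositionalEquality.Core as ≡
open import Relation.Nullary using (yes; no)

-- Normal forms are only canonical when the solver can recognise zero coefficients, which
-- needs decidable equality; so the coefficients are taken from ℤ, which maps into any
-- commutative ring.
module IntegerCoefficientSolver {c ℓ} (R : CommutativeRing c ℓ) where
  open CommutativeRing R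
  open Algebra.Properties.Semiring.Mult semiring using (×-homo-+; ×1-homo-*)
    renaming (_×_ to _·_)
  open Algebra.Properties.Ring ring using (-‿distribˡ-*; -‿distribʳ-*)
  open Algebra.Properties.AbelianGroup +-abelianGroup using (ε⁻¹≈ε; ⁻¹-involutive; ⁻¹-∙-comm)
  open Algebra.Properties.CommutativeSemigroup +-commutativeSemigroup using (interchange)
  open import Relation.Binary.Reasoning.Setoid setoid

  -- Unlike n · 1#, this sends 1 and 2 to 1# and 1# + 1# on the nose, so that identities
  -- proved by solve can mention 1# and 2# directly.
  ℕ→R : ℕ → Carrier
  ℕ→R zero          = 0#
  ℕ→R (suc zero)    = 1#
  ℕ→R (suc (suc n)) = 1# + ℕ→R (suc n)

  ℕ→R≈·1# : ∀ n → ℕ→R n ≈ n · 1#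
  ℕ→R≈·1# zero          = refl
  ℕ→R≈·1# (suc zero)    = sym (+-identityʳ 1#)
  ℕ→R≈·1# (suc (suc n)) = +-congˡ (ℕ→R≈·1# (suc n))

  ℕ→R-suc : ∀ n → ℕ→R (suc n) ≈ 1# + ℕ→R n
  ℕ→R-suc n = trans (ℕ→R≈·1# (suc n)) (+-congˡ (sym (ℕ→R≈·1# n)))

  ℕ→R-+ : ∀ m n → ℕ→R (m ℕ.+ n) ≈ ℕ→R m + ℕ→R n
  ℕ→R-+ m n = begin
    ℕ→R (m ℕ.+ n)           ≈⟨ ℕ→R≈·1# (m ℕ.+ n) ⟩
    (m ℕ.+ n) · 1#          ≈⟨ ×-homo-+ 1# m n ⟩
    m · 1# + n · 1#         ≈⟨ +-cong (ℕ→R≈·1# m) (ℕ→R≈·1# n) ⟨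
    ℕ→R m + ℕ→R n           ∎

  ℕ→R-* : ∀ m n → ℕ→R (m ℕ.* n) ≈ ℕ→R m * ℕ→R n
  ℕ→R-* m n = begin
    ℕ→R (m ℕ.* n)           ≈⟨ ℕ→R≈·1# (m ℕ.* n) ⟩
    (m ℕ.* n) · 1#          ≈⟨ ×1-homo-* m n ⟩
    (m · 1#) * (n · 1#)     ≈⟨ *-cong (ℕ→R≈·1# m) (ℕ→R≈·1# n) ⟨
    ℕ→R m * ℕ→R n           ∎

  ℤ→R : ℤ → Carrier
  ℤ→R (+ n)    = ℕ→R n
  ℤ→R -[1+ n ] = - ℕ→R (suc n)

  [z+x]-[z+y]≈x-y : ∀ x y z → (z + x) - (z + y) ≈ x - y
  [z+x]-[z+y]≈x-y x y z = begin
    (z + x) - (z + y)       ≈⟨ +-congˡ (⁻¹-∙-comm z y) ⟨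
    (z + x) + (- z - y)     ≈⟨ interchange z x (- z) (- y) ⟩
    (z - z) + (x - y)       ≈⟨ +-congʳ (-‿inverseʳ z) ⟩
    0# + (x - y)            ≈⟨ +-identityˡ (x - y) ⟩
    x - y                   ∎

  ℤ→R-⊖ : ∀ m n → ℤ→R (m ⊖ n) ≈ ℕ→R m - ℕ→R n
  ℤ→R-⊖ zero    zero    = sym (-‿inverseʳ 0#)
  ℤ→R-⊖ zero    (suc n) = sym (+-identityˡ _)
  ℤ→R-⊖ (suc m) zero    = sym (trans (+-congˡ ε⁻¹≈ε) (+-identityʳ _))
  ℤ→R-⊖ (suc m) (suc n) = begin
    ℤ→R (suc m ⊖ suc n)             ≡⟨ ≡.cong ℤ→R (ℤ.[1+m]⊖[1+n]≡m⊖n m n) ⟩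
    ℤ→R (m ⊖ n)                     ≈⟨ ℤ→R-⊖ m n ⟩
    ℕ→R m - ℕ→R n                   ≈⟨ [z+x]-[z+y]≈x-y (ℕ→R m) (ℕ→R n) 1# ⟨
    (1# + ℕ→R m) - (1# + ℕ→R n)     ≈⟨ +-cong (ℕ→R-suc m) (-‿cong (ℕ→R-suc n)) ⟨
    ℕ→R (suc m) - ℕ→R (suc n)       ∎

  ℤ→R-+ : ∀ i j → ℤ→R (i ℤ.+ j) ≈ ℤ→R i + ℤ→R j
  ℤ→R-+ (+ m)    (+ n)    = ℕ→R-+ m n
  ℤ→R-+ (+ m)    -[1+ n ] = ℤ→R-⊖ m (suc n)
  ℤ→R-+ -[1+ m ] (+ n)    = trans (ℤ→R-⊖ n (suc m)) (+-comm _ _)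
  ℤ→R-+ -[1+ m ] -[1+ n ] = begin
    - ℕ→R (suc (suc (m ℕ.+ n)))         ≡⟨ ≡.cong (λ k → - ℕ→R (suc k)) (ℕ.+-suc m n) ⟨
    - ℕ→R (suc m ℕ.+ suc n)             ≈⟨ -‿cong (ℕ→R-+ (suc m) (suc n)) ⟩
    - (ℕ→R (suc m) + ℕ→R (suc n))       ≈⟨ ⁻¹-∙-comm _ _ ⟨
    - ℕ→R (suc m) + - ℕ→R (suc n)       ∎

  ℤ→R-neg : ∀ i → ℤ→R (ℤ.- i) ≈ - ℤ→R i
  ℤ→R-neg (+ zero)  = sym ε⁻¹≈ε
  ℤ→R-neg (+ suc n) = refl
  ℤ→R-neg -[1+ n ]  = sym (⁻¹-involutive _)

  ℤ→R-+* : ∀ m j → ℤ→R (+ m ℤ.* j) ≈ ℕ→R m * ℤ→R j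
  ℤ→R-+* m (+ n) = begin
    ℤ→R (+ m ℤ.* + n)                   ≡⟨ ≡.cong ℤ→R (ℤ.pos-* m n) ⟨
    ℕ→R (m ℕ.* n)                       ≈⟨ ℕ→R-* m n ⟩
    ℕ→R m * ℕ→R n                       ∎
  ℤ→R-+* m -[1+ n ] = begin
    ℤ→R (+ m ℤ.* ℤ.- + suc n)           ≡⟨ ≡.cong ℤ→R (ℤ.neg-distribʳ-* (+ m) (+ suc n)) ⟨
    ℤ→R (ℤ.- (+ m ℤ.* + suc n))         ≈⟨ ℤ→R-neg (+ m ℤ.* + suc n) ⟩
    - ℤ→R (+ m ℤ.* + suc n)             ≈⟨ -‿cong (ℤ→R-+* m (+ suc n)) ⟩
    - (ℕ→R m * ℕ→R (suc n))             ≈⟨ -‿distribʳ-* (ℕ→R m) (ℕ→R (suc n)) ⟩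
    ℕ→R m * - ℕ→R (suc n)               ∎

  ℤ→R-* : ∀ i j → ℤ→R (i ℤ.* j) ≈ ℤ→R i * ℤ→R j
  ℤ→R-* (+ m)    j = ℤ→R-+* m j
  ℤ→R-* -[1+ m ] j = begin
    ℤ→R (ℤ.- + suc m ℤ.* j)             ≡⟨ ≡.cong ℤ→R (ℤ.neg-distribˡ-* (+ suc m) j) ⟨
    ℤ→R (ℤ.- (+ suc m ℤ.* j))           ≈⟨ ℤ→R-neg (+ suc m ℤ.* j) ⟩
    - ℤ→R (+ suc m ℤ.* j)               ≈⟨ -‿cong (ℤ→R-+* (suc m) j) ⟩
    - (ℕ→R (suc m) * ℤ→R j)             ≈⟨ -‿distribˡ-* (ℕ→R (suc m)) (ℤ→R j) ⟩
    - ℕ→R (suc m) * ℤ→R j               ∎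

  ℤ→R-homomorphism : ℤ.+-*-rawRing -Raw-AlmostCommutative⟶ fromCommutativeRing R
  ℤ→R-homomorphism = record
    { ⟦_⟧    = ℤ→R
    ; +-homo = ℤ→R-+
    ; *-homo = ℤ→R-*
    ; -‿homo = ℤ→R-neg
    ; 0-homo = refl
    ; 1-homo = refl
    }

  ℤ→R-≟ : ∀ i j → Maybe (ℤ→R i ≈ ℤ→R j)
  ℤ→R-≟ i j with i ℤ.≟ j
  ... | yes ≡.refl = just refl
  ... | no _       = nothing

  open Algebra.Solver.Ring ℤ.+-*-rawRing (fromCommutativeRing R) ℤ→R-homomorphism ℤ→R-≟
    public using (Polynomial; solve; _:=_; con; _:+_; _:*_; _:-_; :-_)

  1ₚ 2ₚ : ∀ {n} → Polynomial n
  1ₚ = con (+ 1)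
  2ₚ = con (+ 2)

  -- The solver proves an identity L ≈ R + k * (p - q) in which a hypothesis p ≈ q
  -- appears as a multiple of p - q; these lemmas then drop such terms.
  drop-multiple : ∀ {L R k p q} → L ≈ R + k * (p - q) → p ≈ q → L ≈ R
  drop-multiple {R = R} {k} L≈ p≈q = begin
    _                   ≈⟨ L≈ ⟩
    R + k * (_ - _)     ≈⟨ +-congˡ (*-congˡ (trans (+-congʳ p≈q) (-‿inverseʳ _))) ⟩
    R + k * 0#          ≈⟨ +-congˡ (zeroʳ k) ⟩
    R + 0#              ≈⟨ +-identityʳ R ⟩
    R                   ∎

  drop-multiples₂ : ∀ {L R k₁ p₁ q₁ k₂ p₂ q₂} →
                    L ≈ R + k₁ * (p₁ - q₁) + k₂ * (p₂ - q₂) →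
                    p₁ ≈ q₁ → p₂ ≈ q₂ → L ≈ R
  drop-multiples₂ L≈ e₁ e₂ = drop-multiple (drop-multiple L≈ e₂) e₁

  drop-multiples₃ : ∀ {L R k₁ p₁ q₁ k₂ p₂ q₂ k₃ p₃ q₃} →
                    L ≈ R + k₁ * (p₁ - q₁) + k₂ * (p₂ - q₂) + k₃ * (p₃ - q₃) →
                    p₁ ≈ q₁ → p₂ ≈ q₂ → p₃ ≈ q₃ → L ≈ R
  drop-multiples₃ L≈ e₁ e₂ e₃ = drop-multiple (drop-multiples₂ L≈ e₂ e₃) e₁

module FieldProperties {c ℓ} (F : Field c ℓ) where
  open Field F
  open FieldNotions F
  open IntegerCoefficientSolver commutativeRing
  open Algebra.Properties.CommutativeSemigroup *-commutativeSemigroup using (x∙yz≈z∙yx; interchange)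

  x*y≉0⇒x≉0 : ∀ {x y} → x * y ≉ 0# → x ≉ 0#
  x*y≉0⇒x≉0 {y = y} xy≉0 x≈0 = xy≉0 (trans (*-congʳ x≈0) (zeroˡ y))

  x*y≉0⇒y≉0 : ∀ {x y} → x * y ≉ 0# → y ≉ 0#
  x*y≉0⇒y≉0 {x} xy≉0 y≈0 = xy≉0 (trans (*-congˡ y≈0) (zeroʳ x))

  x*y≈1⇒y≉0 : ∀ {x y} → x * y ≈ 1# → y ≉ 0#
  x*y≈1⇒y≉0 xy≈1 = x*y≉0⇒y≉0 (λ xy≈0 → 0≉1 (trans (sym xy≈0) xy≈1))

  x≉0∧y≉0⇒x*y≉0 : ∀ {x y} → x ≉ 0# → y ≉ 0# → x * y ≉ 0#
  x≉0∧y≉0⇒x*y≉0 {x} {y} x≉0 y≉0 xy≈0 = y≉0 (begin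
    y                   ≈⟨ *-identityʳ y ⟨
    y * 1#              ≈⟨ *-congˡ (⁻¹-inverse x x≉0) ⟨
    y * (x * x ⁻¹)      ≈⟨ x∙yz≈z∙yx y x (x ⁻¹) ⟩
    x ⁻¹ * (x * y)      ≈⟨ *-congˡ xy≈0 ⟩
    x ⁻¹ * 0#           ≈⟨ zeroʳ (x ⁻¹) ⟩
    0#                  ∎)
    where open import Relation.Binary.Reasoning.Setoid setoid

  [x/y]²≈1 : ∀ {x y} → y ≉ 0# → x * x ≈ y * y → (x * y ⁻¹) * (x * y ⁻¹) ≈ 1#
  [x/y]²≈1 {x} {y} y≉0 x²≈y² = drop-multiples₂ (identity x (y ⁻¹) y) x²≈y² (⁻¹-inverse y y≉0)
    where
    identity : ∀ x e y →
      (x * e) * (x * e) ≈ 1# + (e * e) * (x * x - y * y) + (y * e + 1#) * (y * e - 1#)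
    identity = solve 3 (λ x e y →
      (x :* e) :* (x :* e) :=
        1ₚ :+ (e :* e) :* (x :* x :- y :* y) :+ (y :* e :+ 1ₚ) :* (y :* e :- 1ₚ)) refl

  IsSquare-resp-≈ : ∀ {x y} → x ≈ y → IsSquare x → IsSquare y
  IsSquare-resp-≈ x≈y (u , x≈u²) = u , trans (sym x≈y) x≈u²

  IsSquare-* : ∀ {x y} → IsSquare x → IsSquare y → IsSquare (x * y)
  IsSquare-* (u , x≈u²) (w , y≈w²) = u * w , trans (*-cong x≈u² y≈w²) (interchange u u w w)

  -- w = ((1 + i) + (1 − i)ε)/2 is 1 at ε = 1 and i at ε = −1. A single formula is needed
  -- because equality in F is not decidable, so the proof cannot split on ε ≈ 1 ⊎ ε ≈ - 1.
  x*x≈1⇒IsSquare : CharNot2 → IsSquare (- 1#) → ∀ {ε} → ε * ε ≈ 1# → IsSquare ε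
  x*x≈1⇒IsSquare char≠2 (i , -1≈i²) {ε} ε²≈1 =
    w , sym (drop-multiples₃ (identity i (2# ⁻¹) ε) ε²≈1 (⁻¹-inverse 2# char≠2) (sym -1≈i²))
    where
    w = (1# + i) * 2# ⁻¹ + (1# - i) * 2# ⁻¹ * ε
    identity : ∀ i h ε →
      ((1# + i) * h + (1# - i) * h * ε) * ((1# + i) * h + (1# - i) * h * ε) ≈
        ε + (- (2# * i * h * h)) * (ε * ε - 1#) + (ε * (2# * h + 1#)) * (2# * h - 1#)
        + (h * h * (1# - ε) * (1# - ε)) * (i * i - (- 1#))
    identity = solve 3 (λ i h ε →
      ((1ₚ :+ i) :* h :+ (1ₚ :- i) :* h :* ε) :* ((1ₚ :+ i) :* h :+ (1ₚ :- i) :* h :* ε) :=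
        ε :+ (:- (2ₚ :* i :* h :* h)) :* (ε :* ε :- 1ₚ) :+ (ε :* (2ₚ :* h :+ 1ₚ)) :* (2ₚ :* h :- 1ₚ)
        :+ (h :* h :* (1ₚ :- ε) :* (1ₚ :- ε)) :* (i :* i :- (:- 1ₚ))) refl

  square-up-to-sign : ∀ {g d δ} → CharNot2 → IsSquare (- 1#) → d ≉ 0# → δ * δ ≈ d * d →
                      IsSquare (g * d) → IsSquare (g * δ)
  square-up-to-sign {g} {d} {δ} char≠2 √-1 d≉0 δ²≈d² gd-square =
    IsSquare-resp-≈ (drop-multiple (identity g d δ (d ⁻¹)) (⁻¹-inverse d d≉0))
      (IsSquare-* gd-square (x*x≈1⇒IsSquare char≠2 √-1 ([x/y]²≈1 d≉0 δ²≈d²)))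
    where
    identity : ∀ g d δ e → (g * d) * (δ * e) ≈ g * δ + (g * δ) * (d * e - 1#)
    identity = solve 4 (λ g d δ e →
      (g :* d) :* (δ :* e) := g :* δ :+ (g :* δ) :* (d :* e :- 1ₚ)) refl

module AGM {c ℓ} (F : Field c ℓ) (char≠2 : FieldNotions.CharNot2 F) where
  open Field F
  open FieldNotions F
  open IntegerCoefficientSolver commutativeRing
  open FieldProperties F

  half : Carrier → Carrier
  half x = x * 2# ⁻¹

  2*2⁻¹≈1 : 2# * 2# ⁻¹ ≈ 1#
  2*2⁻¹≈1 = ⁻¹-inverse 2# char≠2

  2*x≈y⇒half-y≈x : ∀ {x y} → 2# * x ≈ y → half y ≈ x
  2*x≈y⇒half-y≈x {x} {y} 2x≈y = drop-multiples₂ (identity x y (2# ⁻¹)) (sym 2x≈y) 2*2⁻¹≈1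
    where
    identity : ∀ x y h → y * h ≈ x + h * (y - 2# * x) + x * (2# * h - 1#)
    identity = solve 3 (λ x y h → y :* h := x :+ h :* (y :- 2ₚ :* x) :+ x :* (2ₚ :* h :- 1ₚ)) refl

  half≉0 : ∀ {x} → x ≉ 0# → half x ≉ 0#
  half≉0 x≉0 = x≉0∧y≉0⇒x*y≉0 x≉0 (x*y≈1⇒y≉0 2*2⁻¹≈1)

  child : ∀ {a b} d → InS (a , b) → d * d ≈ a * b → (a , b) ↦ (half (a + b) , d)
  child {a} {b} d S@(a≉0 , b≉0 , a+b≉0 , a-b≉0) d²≈ab =
    S , (half≉0 a+b≉0 , d≉0 , x*y≉0⇒x≉0 γ²-d²≉0 , x*y≉0⇒y≉0 γ²-d²≉0) , 2γ≈a+b , d²≈ab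
    where
    h = 2# ⁻¹
    d≉0 = x*y≉0⇒x≉0 (λ d²≈0 → x≉0∧y≉0⇒x*y≉0 a≉0 b≉0 (trans (sym d²≈ab) d²≈0))
    difference-of-squares : ∀ a b d h →
      ((a + b) * h + d) * ((a + b) * h - d) ≈
        ((a - b) * h) * ((a - b) * h)
        + (a * b * (2# * h + 1#)) * (2# * h - 1#) + (- 1#) * (d * d - a * b)
    difference-of-squares = solve 4 (λ a b d h →
      ((a :+ b) :* h :+ d) :* ((a :+ b) :* h :- d) :=
        ((a :- b) :* h) :* ((a :- b) :* h)
        :+ (a :* b :* (2ₚ :* h :+ 1ₚ)) :* (2ₚ :* h :- 1ₚ) :+ (:- 1ₚ) :* (d :* d :- a :* b)) refl
    γ²-d²≉0 : (half (a + b) + d) * (half (a + b) - d) ≉ 0#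
    γ²-d²≉0 e = x≉0∧y≉0⇒x*y≉0 (half≉0 a-b≉0) (half≉0 a-b≉0)
      (trans (sym (drop-multiples₂ (difference-of-squares a b d h) 2*2⁻¹≈1 d²≈ab)) e)
    2γ≈a+b : 2# * half (a + b) ≈ a + b
    2γ≈a+b = drop-multiple (identity (a + b) h) 2*2⁻¹≈1
      where
      identity : ∀ s h → 2# * (s * h) ≈ s + s * (2# * h - 1#)
      identity = solve 2 (λ s h → 2ₚ :* (s :* h) := s :+ s :* (2ₚ :* h :- 1ₚ)) refl

  adv₁⇒square : ∀ {γ δ} → Adv 1 (γ , δ) → IsSquare (γ * δ)
  adv₁⇒square (_ , (_ , u) , (_ , _ , _ , u²≈γδ) , _) = u , sym u²≈γδ

  square⇒adv₁ : ∀ {γ δ} → InS (γ , δ) → IsSquare (γ * δ) → Adv 1 (γ , δ)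
  square⇒adv₁ S (s , γδ≈s²) = S , (_ , s) , γδ↦ , lift (proj₁ (proj₂ γδ↦))
    where γδ↦ = child s S (sym γδ≈s²)

  child-with-square⇒fourthPower : ∀ {a b g d} → 2# * g ≈ a + b → d * d ≈ a * b → IsSquare (g * d) →
                                  IsFourthPower (half (a + b) * half (a + b) * a * b)
  child-with-square⇒fourthPower {a} {b} {g} {d} 2g≈a+b d²≈ab (u , gd≈u²) =
    u , trans (*-congʳ (*-congʳ (*-cong γ≈g γ≈g)))
              (drop-multiples₂ (identity g a b d u) (sym d²≈ab) gd≈u²)
    where
    γ≈g = 2*x≈y⇒half-y≈x 2g≈a+b
    identity : ∀ g a b d u →
      g * g * a * b ≈ u * u * u * u + (g * g) * (a * b - d * d) + (g * d + u * u) * (g * d - u * u)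
    identity = solve 5 (λ g a b d u →
      g :* g :* a :* b :=
        u :* u :* u :* u :+ (g :* g) :* (a :* b :- d :* d) :+ (g :* d :+ u :* u) :* (g :* d :- u :* u)) refl

  adv₂⇒fourthPower : ∀ {a b} → Adv 2 (a , b) → IsFourthPower (half (a + b) * half (a + b) * a * b)
  adv₂⇒fourthPower (_ , _ , (_ , _ , 2g≈a+b , d²≈ab) , adv₁) =
    child-with-square⇒fourthPower 2g≈a+b d²≈ab (adv₁⇒square adv₁)

  fourthPower⇒adv₂ : ∀ {a b} → InS (a , b) →
                     IsFourthPower (half (a + b) * half (a + b) * a * b) → Adv 2 (a , b)
  fourthPower⇒adv₂ {a} {b} S@(_ , _ , a+b≉0 , _) (t , γ²ab≈t⁴) =
    S , (γ , d) , ab↦γd , square⇒adv₁ (proj₁ (proj₂ ab↦γd)) (t , γd≈t²)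
    where
    γ = half (a + b)
    k = γ ⁻¹
    γk≈1 = ⁻¹-inverse γ (half≉0 a+b≉0)
    d = t * t * k
    d²≈ab : d * d ≈ a * b
    d²≈ab = drop-multiples₂ (identity a b γ t k) (sym γ²ab≈t⁴) γk≈1
      where
      identity : ∀ a b γ t k →
        (t * t * k) * (t * t * k) ≈
          a * b + (k * k) * (t * t * t * t - γ * γ * a * b) + (a * b * (γ * k + 1#)) * (γ * k - 1#)
      identity = solve 5 (λ a b γ t k →
        (t :* t :* k) :* (t :* t :* k) :=
          a :* b :+ (k :* k) :* (t :* t :* t :* t :- γ :* γ :* a :* b)
          :+ (a :* b :* (γ :* k :+ 1ₚ)) :* (γ :* k :- 1ₚ)) refl
    γd≈t² : γ * d ≈ t * t
    γd≈t² = drop-multiple (identity γ t k) γk≈1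
      where
      identity : ∀ γ t k → γ * (t * t * k) ≈ t * t + (t * t) * (γ * k - 1#)
      identity = solve 3 (λ γ t k → γ :* (t :* t :* k) := t :* t :+ (t :* t) :* (γ :* k :- 1ₚ)) refl
    ab↦γd = child d S d²≈ab

  adv₂⇒children-adv₁ : ∀ {a b} → Adv 2 (a , b) → IsSquare (- 1#) →
                       ∀ γ δ → (a , b) ↦ (γ , δ) → Adv 1 (γ , δ)
  adv₂⇒children-adv₁ (_ , (g , d) , (_ , (_ , d≉0 , _) , 2g≈a+b , d²≈ab) , adv₁) √-1
                     γ δ (_ , S , 2γ≈a+b , δ²≈ab)
    = square⇒adv₁ S (IsSquare-resp-≈ (*-congʳ (sym γ≈g))
        (square-up-to-sign char≠2 √-1 d≉0 (trans δ²≈ab (sym d²≈ab)) (adv₁⇒square adv₁)))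
    where
    γ≈g = trans (sym (2*x≈y⇒half-y≈x 2γ≈a+b)) (2*x≈y⇒half-y≈x 2g≈a+b)

lemma2p2 : ∀ {c ℓ} (F : Field c ℓ) →
    let open Field F
        open FieldNotions F
    in CharNot2 → ∀ (a₀ b₀ : Carrier) → InS (a₀ , b₀) →
       (Adv 2 (a₀ , b₀) ⇔
          IsFourthPower (((a₀ + b₀) * 2# ⁻¹) * ((a₀ + b₀) * 2# ⁻¹) * a₀ * b₀))
       × (Adv 2 (a₀ , b₀) → IsSquare (- 1#) →
          ∀ (γ δ : Carrier) → (a₀ , b₀) ↦ (γ , δ) → Adv 1 (γ , δ))
lemma2p2 F char≠2 a₀ b₀ S =
  mk⇔ adv₂⇒fourthPower (fourthPower⇒adv₂ S) , adv₂⇒children-adv₁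
  where open AGM F char≠2
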